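{- Let $q$ be a prime power, $\ell$ a prime with $\ell\nmid q$, integers $0\le\alpha\le\beta\le\gamma$, $d\in(\mathbb{Z}/\ell^\gamma\mathbb{Z})^\times$ with $(d^2q-1,\ell^\gamma)=\ell^\beta$, $t\in\mathbb{Z}$ and $\Delta=t^2-4q$. If $\beta<\gamma$, then \[ 2\sum_{j=0}^{\beta-\alpha}\frac{\varphi(\ell^{2j})\varphi(\ell^{\gamma-\alpha-j})}{\varphi(\ell^{\gamma-\alpha})}H_{\ell^\gamma,\ell^{\alpha+j}}(t,q,d)=H\Big(\frac{\Delta}{\ell^{2\alpha}}\Big)D(t;\ell^{\alpha+\gamma})+\sum_{j=1}^{\beta-\alpha}H\Big(\frac{\Delta}{\ell^{2(\alpha+j)}}\Big)\Big(\ell^jD(t;\ell^{\alpha+\gamma+j})-\ell^{j-1}D(t;\ell^{\alpha+\gamma+j-1})\Big), \] and if $\beta=\gamma$, then \[ 2\sum_{j=0}^{\beta-\alpha}\frac{\varphi(\ell^{2j})\varphi(\ell^{\gamma-\alpha-j})}{\varphi(\ell^{\gamma-\alpha})}H_{\ell^\gamma,\ell^{\alpha+j}}(t,q,d)=H\Big(\frac{\Delta}{\ell^{2\alpha}}\Big)D(t;\ell^{\alpha+\gamma})+\sum_{j=1}^{\gamma-\alpha-1}H\Big(\frac{\Delta}{\ell^{2(\alpha+j)}}\Big)\Big(\ell^jD(t;\ell^{\alpha+\gamma+j})-\ell^{j-1}D(t;\ell^{\alpha+\gamma+j-1})\Big)+\ell^{\gamma-\alpha}D(t;\ell^{2\gamma})H\Big(\frac{\Delta}{\ell^{2\gamma}}\Big).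 \]
   Context: $\varphi$ is Euler's function; $\delta_c(a,b)=1$ if $a\equiv b\pmod c$, else $0$. For $n\mid\ell^{\gamma+\beta}$, $D(t;n)=\delta_n(dq+d^{ -1},t)$ (well defined, independent of the lift of $d$, since $d^2q\equiv1\pmod{\ell^\beta}$). For $d'<0$, $d'\equiv0,1\pmod4$, $h(d')$ is the class number of the quadratic order of discriminant $d'$; $h_w(d')=h(d')/3$ if $d'=-3$, $h(d')/2$ if $d'=-4$, $h(d')$ for other negative $d'\equiv0,1\pmod4$, and $h_w(x)=0$ for all other $x$. $H(x)=\sum_{f\ge1,f^2\mid x}h_w(x/f^2)$ if $x$ is a nonzero integer and $H(x)=0$ if $x\notin\mathbb{Z}$ or $x\ge0$ gives only zero terms. For $0\le\delta\le e$: $H_{\ell^e,\ell^\delta}(t,q,d)=\frac12H\big(\frac{\Delta}{\ell^{2\delta}}\big)\delta_{\ell^\delta}(d^2q,1)D(t;\ell^{e+\delta})-\sum_{k=1}^{e-\delta-1}\frac12H\big(\frac{\Delta}{\ell^{2(\delta+k)}}\big)\delta_{\ell^{\delta+k}}(d^2q,1)\big(D(t;\ell^{e+\delta+k-1})-D(t;\ell^{e+\delta+k})\big)$, where a term is $0$ whenever its factor $\delta_{\ell^{\cdot}}(d^2q,1)$ vanishes. -}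

module Defs where

open import Data.Bool using (Bool; true; false; if_then_else_; _∧_; _∨_; not)
open import Data.Nat as ℕ using (ℕ; zero; suc; _∸_; _^_)
open import Data.Nat.GCD using (gcd)
open import Data.Nat.Divisibility using (_∣?_)
open import Data.Nat.DivMod using (_/_; _%_)
open import Data.Integer as ℤ using (ℤ; +_; -[1+_]; ∣_∣)
open import Data.Rational as ℚ using (ℚ; 0ℚ; 1ℚ)
open import Data.List using (List; []; _∷_; length; filter; upTo; map; concatMap; foldr)
open import Relation.Nullary using (does)

ℕ→ℚ : ℕ → ℚ
ℕ→ℚ n = ℚ._/_ (+ n) 1

-- n / m as a rational, with the (never used here) convention n / 0 = 0
fracℚ : ℕ → ℕ → ℚ
fracℚ n zero    = 0ℚ
fracℚ n (suc m) = ℚ._/_ (+ n) (suc m)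

-- Σ_{j=a}^{b} f j  (empty, i.e. 0, when b < a)
sumℚ : ℕ → ℕ → (ℕ → ℚ) → ℚ
sumℚ a b f = foldr (λ k acc → f (a ℕ.+ k) ℚ.+ acc) 0ℚ (upTo (suc b ∸ a))

δ : ℕ → ℤ → ℤ → ℚ
δ c x y = if does (c ∣? ∣ x ℤ.- y ∣) then 1ℚ else 0ℚ

φ : ℕ → ℕ
φ n = length (filter (λ k → gcd (suc k) n ℕ.≟ 1) (upTo n))

-- For M > 0, classNo M = h(-M): the number of reduced primitive positive
-- definite binary quadratic forms a x² + b x y + c y² of discriminant
-- b² - 4ac = -M, i.e. |b| ≤ a ≤ c, b ≥ 0 if |b| = a or a = c,
-- gcd(a,b,c) = 1, a ≥ 1.  (Every such form has 1 ≤ a ≤ M, |b| ≤ M,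
-- 1 ≤ c ≤ M, so the enumeration below is exhaustive.)

isReduced : ℕ → ℕ → ℤ → ℕ → Bool
isReduced M a b c =
  does (ℤ._≟_ (+ (4 ℕ.* a ℕ.* c)) (b ℤ.* b ℤ.+ + M))
  ∧ does (∣ b ∣ ℕ.≤? a)
  ∧ does (a ℕ.≤? c)
  ∧ (not (does (∣ b ∣ ℕ.≟ a) ∨ does (a ℕ.≟ c)) ∨ does (+ 0 ℤ.≤? b))
  ∧ does (gcd (gcd a ∣ b ∣) c ℕ.≟ 1)

intRange : ℕ → List ℤ
intRange M = map (λ k → + k ℤ.- + M) (upTo (suc (2 ℕ.* M)))

countᵇ : {A : Set} → (A → Bool) → List A → ℕ
countᵇ p []       = 0
countᵇ p (x ∷ xs) = (if p x then 1 else 0) ℕ.+ countᵇ p xs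

classNo : ℕ → ℕ
classNo M =
  sumℕ (map (λ a →
    sumℕ (map (λ b →
      countᵇ (λ c → isReduced M a b c) (map suc (upTo M)))
    (intRange M)))
  (map suc (upTo M)))
  where
  sumℕ : List ℕ → ℕ
  sumℕ = foldr ℕ._+_ 0

hw : ℕ → ℚ
hw M with M % 4
... | 0 = if does (M ℕ.≟ 4) then fracℚ (classNo M) 2 else ℕ→ℚ (classNo M)
... | 3 = if does (M ℕ.≟ 3) then fracℚ (classNo M) 3 else ℕ→ℚ (classNo M)
... | _ = 0ℚ

-- Hurwitz class number of -N for N > 0:  H(-N) = Σ_{f ≥ 1, f² ∣ N} h_w(-N/f²)
Hneg : ℕ → ℚ
Hneg N = foldr (λ k acc →
           (if does ((suc k ℕ.* suc k) ∣? N) then hw (N / (suc k ℕ.* suc k)) else 0ℚ) ℚ.+ acc)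
         0ℚ (upTo N)

Hℤ : ℤ → ℚ
Hℤ (+ _)     = 0ℚ
Hℤ -[1+ n ]  = Hneg (suc n)

-- Hfrac Δ m = H(Δ / m) for m ≥ 1: 0 if Δ/m ∉ ℤ (or if Δ/m ≥ 0)
Hfrac : ℤ → ℕ → ℚ
Hfrac (+ _)    m = 0ℚ
Hfrac -[1+ n ] zero = 0ℚ
Hfrac -[1+ n ] m@(suc m') =
  if does (m ∣? suc n) then Hneg (suc n / m) else 0ℚ

-- The data (ℓ, q, t, d, d⁻¹).  d and dinv are integer lifts with
-- d · dinv ≡ 1 (mod ℓ^(γ+β)).

Disc : ℤ → ℕ → ℤ
Disc t q = t ℤ.* t ℤ.- + (4 ℕ.* q)

Dfun : ℕ → ℤ → ℤ → ℤ → ℕ → ℚ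
Dfun q d dinv t n = δ n (d ℤ.* + q ℤ.+ dinv) t

-- H_{ℓ^e, ℓ^δ}(t,q,d)  (exponents e and δ' = δ)
Hsub : ℕ → ℕ → ℤ → ℤ → ℤ → ℕ → ℕ → ℚ
Hsub ℓ q d dinv t e δ' =
  ((fracℚ 1 2 ℚ.* Hfrac Δ (ℓ ^ (2 ℕ.* δ'))) ℚ.* δ (ℓ ^ δ') (d ℤ.* d ℤ.* + q) (+ 1))
     ℚ.* D (ℓ ^ (e ℕ.+ δ'))
  ℚ.- sumℚ 1 (e ∸ δ' ∸ 1) (λ k →
        ((fracℚ 1 2 ℚ.* Hfrac Δ (ℓ ^ (2 ℕ.* (δ' ℕ.+ k))))
           ℚ.* δ (ℓ ^ (δ' ℕ.+ k)) (d ℤ.* d ℤ.* + q) (+ 1))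
        ℚ.* (D (ℓ ^ (e ℕ.+ δ' ℕ.+ k ∸ 1)) ℚ.- D (ℓ ^ (e ℕ.+ δ' ℕ.+ k))))
  where
  Δ = Disc t q
  D = Dfun q d dinv t

{-# OPTIONS --safe #-}
module Submission where

-- Put a = γ - α, h_k = ½ H(Δ/ℓ^{2(α+k)}) and E_k = D(t; ℓ^{α+γ+k}).  Since
-- (d²q - 1, ℓ^γ) = ℓ^β, the factor δ_{ℓ^n}(d²q, 1) is 1 for n ≤ β and 0 for
-- β < n ≤ γ, so H_{ℓ^γ,ℓ^{α+j}} collapses to h_j E_j - Σ_{j<k≤m} h_k (E_{k-1} - E_k)
-- with m = β - α if β < γ and m = a - 1 if β = γ.  By φ(ℓ^{e+1}) = ℓ^e (ℓ - 1) the
-- weight φ(ℓ^{2j}) φ(ℓ^{a-j}) / φ(ℓ^a) is the backward difference ∇P_j of P_j = ℓ^j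
-- for j < a (and is P_a for j = a).  Summation by parts, with Σ_{i<k} ∇P_i = P_{k-1},
-- turns Σ_j ∇P_j (h_j E_j - Σ_{j<k≤m} ...) into Σ_k h_k ∇(P E)_k, which is the
-- right-hand side; for β = γ the extra term j = a gives ℓ^a D(t; ℓ^{2γ}) H(Δ/ℓ^{2γ}).

open import Defs

module FiniteSums where

  open import Data.List using (foldr; applyUpTo)
  open import Data.Nat as ℕ using (ℕ; zero; suc; _∸_; _≤_; _<_; z≤n; s≤s)
  import Data.Nat.Properties as ℕ
  open import Data.Rational using (ℚ; 0ℚ; _+_; _*_; _-_)
  import Data.Rational.Properties as ℚ
  open import Data.Rational.Solver using (module +-*-Solver)
  open import Relation.Binary.PropositionalEquality
  open ≡-Reasoning
  open +-*-Solver

  ∑< : ℕ → (ℕ → ℚ) → ℚ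
  ∑< zero    f = 0ℚ
  ∑< (suc n) f = f 0 + ∑< n (λ k → f (suc k))

  infix 5 ∑<-syntax
  ∑<-syntax : ℕ → (ℕ → ℚ) → ℚ
  ∑<-syntax = ∑<
  syntax ∑<-syntax n (λ k → e) = ∑[ k < n ] e

  foldr-applyUpTo≡∑< : ∀ (f : ℕ → ℚ) (g : ℕ → ℕ) n →
                       foldr (λ k acc → f k + acc) 0ℚ (applyUpTo g n) ≡ ∑[ k < n ] f (g k)
  foldr-applyUpTo≡∑< f g zero    = refl
  foldr-applyUpTo≡∑< f g (suc n) = cong (f (g 0) +_) (foldr-applyUpTo≡∑< f (λ k → g (suc k)) n)

  sumℚ≡∑< : ∀ a b f → sumℚ a b f ≡ ∑[ k < suc b ∸ a ] f (a ℕ.+ k)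
  sumℚ≡∑< a b f = foldr-applyUpTo≡∑< (λ k → f (a ℕ.+ k)) (λ k → k) (suc b ∸ a)

  ∑<-cong : ∀ n {f g : ℕ → ℚ} → (∀ {k} → k < n → f k ≡ g k) → ∑< n f ≡ ∑< n g
  ∑<-cong zero    f≡g = refl
  ∑<-cong (suc n) f≡g = cong₂ _+_ (f≡g (s≤s z≤n)) (∑<-cong n (λ k<n → f≡g (s≤s k<n)))

  ∑<-zero : ∀ n {f : ℕ → ℚ} → (∀ {k} → k < n → f k ≡ 0ℚ) → ∑< n f ≡ 0ℚ
  ∑<-zero n f≡0 = trans (∑<-cong n f≡0) (∑<-0ℚ n)
    where
    ∑<-0ℚ : ∀ n → ∑[ k < n ] 0ℚ ≡ 0ℚ
    ∑<-0ℚ zero    = refl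
    ∑<-0ℚ (suc n) = trans (cong (0ℚ +_) (∑<-0ℚ n)) (ℚ.+-identityˡ 0ℚ)

  ∑<-suc : ∀ n f → ∑< (suc n) f ≡ ∑< n f + f n
  ∑<-suc zero    f = trans (ℚ.+-identityʳ (f 0)) (sym (ℚ.+-identityˡ (f 0)))
  ∑<-suc (suc n) f = begin
    f 0 + ∑< (suc n) (λ k → f (suc k))         ≡⟨ cong (f 0 +_) (∑<-suc n (λ k → f (suc k))) ⟩
    f 0 + (∑< n (λ k → f (suc k)) + f (suc n)) ≡⟨ ℚ.+-assoc (f 0) _ _ ⟨
    ∑< (suc n) f + f (suc n)                   ∎

  ∑<-++ : ∀ m n f → ∑< (m ℕ.+ n) f ≡ ∑< m f + (∑[ k < n ] f (m ℕ.+ k))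
  ∑<-++ zero    n f = sym (ℚ.+-identityˡ _)
  ∑<-++ (suc m) n f = begin
    f 0 + ∑< (m ℕ.+ n) (λ k → f (suc k))                          ≡⟨ cong (f 0 +_) (∑<-++ m n (λ k → f (suc k))) ⟩
    f 0 + (∑< m (λ k → f (suc k)) + (∑[ k < n ] f (suc m ℕ.+ k))) ≡⟨ ℚ.+-assoc (f 0) _ _ ⟨
    ∑< (suc m) f + (∑[ k < n ] f (suc m ℕ.+ k))                   ∎

  ∑<-truncate : ∀ {m n} {f : ℕ → ℚ} → m ≤ n → (∀ {k} → m ≤ k → k < n → f k ≡ 0ℚ) → ∑< n f ≡ ∑< m f
  ∑<-truncate {m} {n} {f} m≤n f≡0 = begin
    ∑< n f                                  ≡⟨ cong (λ n → ∑< n f) (ℕ.m+[n∸m]≡n m≤n) ⟨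
    ∑< (m ℕ.+ (n ∸ m)) f                    ≡⟨ ∑<-++ m (n ∸ m) f ⟩
    ∑< m f + (∑[ k < n ∸ m ] f (m ℕ.+ k))  ≡⟨ cong (∑< m f +_) (∑<-zero (n ∸ m) λ k<n∸m →
                                                 f≡0 (ℕ.m≤m+n m _) (subst (m ℕ.+ _ <_) (ℕ.m+[n∸m]≡n m≤n) (ℕ.+-monoʳ-< m k<n∸m))) ⟩
    ∑< m f + 0ℚ                             ≡⟨ ℚ.+-identityʳ _ ⟩
    ∑< m f                                  ∎

  ∑<-distribˡ : ∀ n x f → x * ∑< n f ≡ ∑[ k < n ] x * f k
  ∑<-distribˡ zero    x f = ℚ.*-zeroʳ x
  ∑<-distribˡ (suc n) x f = trans (ℚ.*-distribˡ-+ x (f 0) _) (cong (x * f 0 +_) (∑<-distribˡ n x (λ k → f (suc k))))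

  ∑<-distribʳ : ∀ n x f → ∑< n f * x ≡ ∑[ k < n ] f k * x
  ∑<-distribʳ zero    x f = ℚ.*-zeroˡ x
  ∑<-distribʳ (suc n) x f = trans (ℚ.*-distribʳ-+ x (f 0) _) (cong (f 0 * x +_) (∑<-distribʳ n x (λ k → f (suc k))))

  ∑<-distrib-- : ∀ n f g → ∑[ k < n ] (f k - g k) ≡ ∑< n f - ∑< n g
  ∑<-distrib-- zero    f g = refl
  ∑<-distrib-- (suc n) f g = begin
    (f 0 - g 0) + (∑[ k < n ] (f (suc k) - g (suc k)))              ≡⟨ cong ((f 0 - g 0) +_) (∑<-distrib-- n (λ k → f (suc k)) (λ k → g (suc k))) ⟩
    (f 0 - g 0) + (∑< n (λ k → f (suc k)) - ∑< n (λ k → g (suc k))) ≡⟨ solve 4 (λ a b c d → (a :- b) :+ (c :- d) := (a :+ c) :- (b :+ d)) refl (f 0) (g 0) _ _ ⟩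
    ∑< (suc n) f - ∑< (suc n) g                                      ∎

  ∇ : (ℕ → ℚ) → ℕ → ℚ
  ∇ P zero    = P 0
  ∇ P (suc j) = P (suc j) - P j

  ∑<-∇ : ∀ P n → ∑[ j < suc n ] ∇ P j ≡ P n
  ∑<-∇ P zero    = ℚ.+-identityʳ (P 0)
  ∑<-∇ P (suc n) = begin
    ∑< (suc (suc n)) (∇ P)          ≡⟨ ∑<-suc (suc n) (∇ P) ⟩
    ∑< (suc n) (∇ P) + ∇ P (suc n)  ≡⟨ cong (_+ ∇ P (suc n)) (∑<-∇ P n) ⟩
    P n + (P (suc n) - P n)         ≡⟨ solve 2 (λ x y → x :+ (y :- x) := y) refl (P n) (P (suc n)) ⟩
    P (suc n)                       ∎

  tailSum : (h E : ℕ → ℚ) → ℕ → ℕ → ℚ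
  tailSum h E m j = ∑[ k < m ] h (suc (j ℕ.+ k)) * (E (j ℕ.+ k) - E (suc (j ℕ.+ k)))

  summation-by-parts : ∀ (P h E : ℕ → ℚ) b →
    ∑[ j < suc b ] ∇ P j * (h j * E j - tailSum h E (b ∸ j) j) ≡ ∑[ k < suc b ] h k * ∇ (λ i → P i * E i) k
  summation-by-parts P h E zero =
    solve 3 (λ p x e → p :* (x :* e :- con 0ℚ) :+ con 0ℚ := x :* (p :* e) :+ con 0ℚ) refl (P 0) (h 0) (E 0)
  summation-by-parts P h E (suc b) = begin
    ∑[ j < suc (suc b) ] A (suc b) j                                      ≡⟨ ∑<-suc (suc b) (A (suc b)) ⟩
    (∑[ j < suc b ] A (suc b) j) + A (suc b) (suc b)                      ≡⟨ cong₂ _+_ (∑<-cong (suc b) grow) last ⟩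
    (∑[ j < suc b ] (A b j - ∇ P j * G)) + ∇ P (suc b) * (hE (suc b) - 0ℚ)
      ≡⟨ cong (_+ ∇ P (suc b) * (hE (suc b) - 0ℚ)) (begin
           ∑[ j < suc b ] (A b j - ∇ P j * G)             ≡⟨ ∑<-distrib-- (suc b) (A b) (λ j → ∇ P j * G) ⟩
           ∑< (suc b) (A b) - (∑[ j < suc b ] ∇ P j * G)  ≡⟨ cong₂ _-_ (summation-by-parts P h E b) (sym (∑<-distribʳ (suc b) G (∇ P))) ⟩
           ∑< (suc b) B - ∑< (suc b) (∇ P) * G            ≡⟨ cong (λ x → ∑< (suc b) B - x * G) (∑<-∇ P b) ⟩
           ∑< (suc b) B - P b * G                         ∎) ⟩
    (∑< (suc b) B - P b * G) + (P (suc b) - P b) * (hE (suc b) - 0ℚ)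
      ≡⟨ solve 6 (λ s p p′ x e e′ → (s :- p :* (x :* (e :- e′))) :+ (p′ :- p) :* (x :* e′ :- con 0ℚ)
                                    := s :+ x :* (p′ :* e′ :- p :* e))
               refl (∑< (suc b) B) (P b) (P (suc b)) (h (suc b)) (E b) (E (suc b)) ⟩
    ∑< (suc b) B + B (suc b)                                              ≡⟨ ∑<-suc (suc b) B ⟨
    ∑< (suc (suc b)) B                                                    ∎
    where
    hE : ℕ → ℚ
    hE j = h j * E j
    A : ℕ → ℕ → ℚ
    A b j = ∇ P j * (hE j - tailSum h E (b ∸ j) j)
    B : ℕ → ℚ
    B k = h k * ∇ (λ i → P i * E i) k
    G : ℚ
    G = h (suc b) * (E b - E (suc b))
    grow : ∀ {j} → j < suc b → A (suc b) j ≡ A b j - ∇ P j * G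
    grow {j} (s≤s j≤b) = begin
      ∇ P j * (hE j - tailSum h E (suc b ∸ j) j)    ≡⟨ cong (λ m → ∇ P j * (hE j - tailSum h E m j)) (ℕ.+-∸-assoc 1 j≤b) ⟩
      ∇ P j * (hE j - tailSum h E (suc (b ∸ j)) j)  ≡⟨ cong (λ t → ∇ P j * (hE j - t)) (∑<-suc (b ∸ j) _) ⟩
      ∇ P j * (hE j - (tailSum h E (b ∸ j) j + h (suc (j ℕ.+ (b ∸ j))) * (E (j ℕ.+ (b ∸ j)) - E (suc (j ℕ.+ (b ∸ j))))))
        ≡⟨ cong (λ i → ∇ P j * (hE j - (tailSum h E (b ∸ j) j + h (suc i) * (E i - E (suc i))))) (ℕ.m+[n∸m]≡n j≤b) ⟩
      ∇ P j * (hE j - (tailSum h E (b ∸ j) j + G))  ≡⟨ solve 4 (λ c x t g → c :* (x :- (t :+ g)) := c :* (x :- t) :- c :* g) refl (∇ P j) (hE j) _ G ⟩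
      A b j - ∇ P j * G                             ∎
    last : A (suc b) (suc b) ≡ ∇ P (suc b) * (hE (suc b) - 0ℚ)
    last = cong (λ m → ∇ P (suc b) * (hE (suc b) - tailSum h E m (suc b))) (ℕ.n∸n≡0 b)

module TotientOfPrimePowers where

  open import Data.Empty using (⊥-elim)
  open import Data.List using ([]; _∷_; _++_; [_]; length; filter; applyUpTo; upTo)
  import Data.List.Properties as List
  open import Data.List.Relation.Unary.All.Properties using (applyUpTo⁺₁)
  open import Data.Nat as ℕ using (ℕ; zero; suc; _+_; _*_; _^_; _<_; s≤s)
  import Data.Nat.Properties as ℕ
  open import Data.Nat.Coprimality using (Coprime; coprime⇒gcd≡1; coprime-divisor)
  open import Data.Nat.Divisibility using (_∣_; ∣-refl; ∣-trans; ∣⇒≤; ∣1⇒≡1; ∣m∣n⇒∣m+n; ∣m+n∣m⇒∣n; m∣m*n; n∣m*n)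
  open import Data.Nat.GCD using (gcd; gcd-greatest)
  open import Data.Nat.Primality using (Prime; prime⇒irreducible; prime⇒nonTrivial)
  open import Data.Product using (_,_)
  open import Data.Sum using (inj₁; inj₂)
  open import Relation.Binary.PropositionalEquality hiding ([_])
  open import Relation.Nullary using (¬_)
  open import Relation.Unary using (Decidable)
  open ≡-Reasoning

  applyUpTo-++ : ∀ {A : Set} (f : ℕ → A) m n → applyUpTo f (m + n) ≡ applyUpTo f m ++ applyUpTo (λ i → f (m + i)) n
  applyUpTo-++ f zero    n = refl
  applyUpTo-++ f (suc m) n = cong (f 0 ∷_) (applyUpTo-++ (λ i → f (suc i)) m n)

  module _ {L : ℕ} {P : ℕ → Set} (P? : Decidable P)
           (accept : ∀ x → ¬ suc L ∣ suc x → P x) (reject : ∀ x → suc L ∣ suc x → ¬ P x) where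

    private ℓ = suc L

    count-block : ∀ s → ℓ ∣ s → length (filter P? (applyUpTo (s +_) ℓ)) ≡ L
    count-block s ℓ∣s = begin
      length (filter P? (applyUpTo (s +_) ℓ))                        ≡⟨ cong (λ xs → length (filter P? xs)) (List.applyUpTo-∷ʳ (s +_) L) ⟨
      length (filter P? (applyUpTo (s +_) L ++ [ s + L ]))            ≡⟨ cong length (List.filter-++ P? (applyUpTo (s +_) L) _) ⟩
      length (filter P? (applyUpTo (s +_) L) ++ filter P? [ s + L ])  ≡⟨ cong₂ (λ xs ys → length (xs ++ ys))
                                                                             (List.filter-all P? (applyUpTo⁺₁ (s +_) L inner))
                                                                             (List.filter-reject P? (reject (s + L) boundary)) ⟩
      length (applyUpTo (s +_) L ++ [])                               ≡⟨ cong length (List.++-identityʳ (applyUpTo (s +_) L)) ⟩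
      length (applyUpTo (s +_) L)                                     ≡⟨ List.length-applyUpTo (s +_) L ⟩
      L                                                               ∎
      where
      inner : ∀ {i} → i < L → P (s + i)
      inner {i} i<L = accept (s + i) λ ℓ∣s+i+1 →
        ℕ.<⇒≱ (s≤s i<L) (∣⇒≤ (∣m+n∣m⇒∣n (subst (ℓ ∣_) (sym (ℕ.+-suc s i)) ℓ∣s+i+1) ℓ∣s))
      boundary : ℓ ∣ suc (s + L)
      boundary = subst (ℓ ∣_) (ℕ.+-suc s L) (∣m∣n⇒∣m+n ℓ∣s ∣-refl)

    count-upTo-multiple : ∀ m → length (filter P? (upTo (m * ℓ))) ≡ m * L
    count-upTo-multiple zero    = refl
    count-upTo-multiple (suc m) = begin
      length (filter P? (upTo (ℓ + m * ℓ)))                                           ≡⟨ cong (λ n → length (filter P? (upTo n))) (ℕ.+-comm ℓ (m * ℓ)) ⟩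
      length (filter P? (upTo (m * ℓ + ℓ)))                                           ≡⟨ cong (λ xs → length (filter P? xs)) (applyUpTo-++ (λ i → i) (m * ℓ) ℓ) ⟩
      length (filter P? (upTo (m * ℓ) ++ applyUpTo (m * ℓ +_) ℓ))                     ≡⟨ cong length (List.filter-++ P? (upTo (m * ℓ)) _) ⟩
      length (filter P? (upTo (m * ℓ)) ++ filter P? (applyUpTo (m * ℓ +_) ℓ))         ≡⟨ List.length-++ (filter P? (upTo (m * ℓ))) ⟩
      length (filter P? (upTo (m * ℓ))) + length (filter P? (applyUpTo (m * ℓ +_) ℓ)) ≡⟨ cong₂ _+_ (count-upTo-multiple m) (count-block (m * ℓ) (n∣m*n m)) ⟩
      m * L + L                                                                       ≡⟨ ℕ.+-comm (m * L) L ⟩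
      suc m * L                                                                       ∎

  module _ {L : ℕ} (ℓ-prime : Prime (suc L)) where

    private ℓ = suc L

    ℓ≢1 : ℓ ≢ 1
    ℓ≢1 = ℕ.nonTrivial⇒≢1 {{prime⇒nonTrivial ℓ-prime}}

    coprime-prime-power : ∀ {x} → ¬ ℓ ∣ x → ∀ e → Coprime x (ℓ ^ e)
    coprime-prime-power ℓ∤x zero    (_ , i∣1)         = ∣1⇒≡1 i∣1
    coprime-prime-power ℓ∤x (suc e) {i} (i∣x , i∣ℓℓᵉ) = coprime-prime-power ℓ∤x e (i∣x , coprime-divisor i⊥ℓ i∣ℓℓᵉ)
      where
      i⊥ℓ : Coprime i ℓ
      i⊥ℓ (j∣i , j∣ℓ) with prime⇒irreducible ℓ-prime j∣ℓ
      ... | inj₁ j≡1 = j≡1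
      ... | inj₂ refl = ⊥-elim (ℓ∤x (∣-trans j∣i i∣x))

    φ-prime-power : ∀ n → φ (ℓ ^ suc n) ≡ ℓ ^ n * L
    φ-prime-power n = begin
      φ (ℓ ^ suc n)                          ≡⟨ cong (λ m → length (filter P? (upTo m))) (ℕ.*-comm ℓ (ℓ ^ n)) ⟩
      length (filter P? (upTo (ℓ ^ n * ℓ)))  ≡⟨ count-upTo-multiple P? accept reject (ℓ ^ n) ⟩
      ℓ ^ n * L                              ∎
      where
      P? = λ k → gcd (suc k) (ℓ ^ suc n) ℕ.≟ 1
      accept : ∀ x → ¬ ℓ ∣ suc x → gcd (suc x) (ℓ ^ suc n) ≡ 1
      accept x ℓ∤x = coprime⇒gcd≡1 (coprime-prime-power ℓ∤x (suc n))
      reject : ∀ x → ℓ ∣ suc x → gcd (suc x) (ℓ ^ suc n) ≢ 1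
      reject x ℓ∣x gcd≡1 = ℓ≢1 (∣1⇒≡1 (subst (ℓ ∣_) gcd≡1 (gcd-greatest ℓ∣x (m∣m*n (ℓ ^ n)))))

module TotientRatios where

  open import Data.Integer as ℤ using (+_)
  import Data.Integer.Properties as ℤ
  open import Data.Nat as ℕ using (ℕ; zero; suc; _+_; _*_; _^_; _∸_; _<_; NonZero)
  import Data.Nat.Properties as ℕ
  open import Data.Nat.Primality using (Prime)
  open import Data.Nat.Solver using () renaming (module +-*-Solver to NS)
  open import Data.Product using (_,_)
  open import Data.Rational as ℚ using (toℚᵘ)
  import Data.Rational.Properties as ℚ
  open import Data.Rational.Solver using (module +-*-Solver)
  open import Data.Rational.Unnormalised as ℚᵘ using (mkℚᵘ; *≡*)
  import Data.Rational.Unnormalised.Properties as ℚᵘ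
  open import Relation.Binary.PropositionalEquality
  open +-*-Solver
  open FiniteSums using (∇)
  open TotientOfPrimePowers using (ℓ≢1; φ-prime-power)

  ℕ→ℚ-+ : ∀ m n → ℕ→ℚ (m + n) ≡ ℕ→ℚ m ℚ.+ ℕ→ℚ n
  ℕ→ℚ-+ m n = ℚ.toℚᵘ-injective (begin
    toℚᵘ (ℕ→ℚ (m + n))                ≈⟨ ℚ.toℚᵘ-fromℚᵘ (mkℚᵘ (+ (m + n)) 0) ⟩
    mkℚᵘ (+ (m + n)) 0                 ≈⟨ *≡* (cong (ℤ._* + 1) (trans (ℤ.pos-+ m n) (sym (cong₂ ℤ._+_ (ℤ.*-identityʳ (+ m)) (ℤ.*-identityʳ (+ n)))))) ⟩
    mkℚᵘ (+ m) 0 ℚᵘ.+ mkℚᵘ (+ n) 0    ≈⟨ ℚᵘ.+-cong (ℚ.toℚᵘ-fromℚᵘ (mkℚᵘ (+ m) 0)) (ℚ.toℚᵘ-fromℚᵘ (mkℚᵘ (+ n) 0)) ⟨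
    toℚᵘ (ℕ→ℚ m) ℚᵘ.+ toℚᵘ (ℕ→ℚ n)    ≈⟨ ℚ.toℚᵘ-homo-+ (ℕ→ℚ m) (ℕ→ℚ n) ⟨
    toℚᵘ (ℕ→ℚ m ℚ.+ ℕ→ℚ n)            ∎)
    where open ℚᵘ.≃-Reasoning

  fracℚ-exact : ∀ m d .{{_ : NonZero d}} {n} → n ≡ m * d → fracℚ n d ≡ ℕ→ℚ m
  fracℚ-exact m (suc d) refl =
    ℚ.fromℚᵘ-cong {mkℚᵘ (+ (m * suc d)) d} {mkℚᵘ (+ m) 0} (*≡* (trans (ℤ.*-identityʳ _) (ℤ.pos-* m (suc d))))

  ∇-pow : ∀ L j → ∇ (λ i → ℕ→ℚ (suc L ^ i)) (suc j) ≡ ℕ→ℚ (suc L ^ j * L)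
  ∇-pow L j = begin
    ℕ→ℚ (ℓ ^ j + L * ℓ ^ j) ℚ.- ℕ→ℚ (ℓ ^ j)             ≡⟨ cong (ℚ._- ℕ→ℚ (ℓ ^ j)) (ℕ→ℚ-+ (ℓ ^ j) (L * ℓ ^ j)) ⟩
    (ℕ→ℚ (ℓ ^ j) ℚ.+ ℕ→ℚ (L * ℓ ^ j)) ℚ.- ℕ→ℚ (ℓ ^ j)  ≡⟨ solve 2 (λ x y → (x :+ y) :- x := y) refl (ℕ→ℚ (ℓ ^ j)) _ ⟩
    ℕ→ℚ (L * ℓ ^ j)                                      ≡⟨ cong ℕ→ℚ (ℕ.*-comm L (ℓ ^ j)) ⟩
    ℕ→ℚ (ℓ ^ j * L)                                      ∎
    where open ≡-Reasoning; ℓ = suc L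

  module _ {L : ℕ} (ℓ-prime : Prime (suc L)) where

    private
      ℓ = suc L
      instance
        L-nonZero : NonZero L
        L-nonZero = ℕ.≢-nonZero λ { refl → ℓ≢1 ℓ-prime refl }
      φ-nonZero : ∀ n → NonZero (φ (ℓ ^ suc n))
      φ-nonZero n = subst NonZero (sym (φ-prime-power ℓ-prime n)) (ℕ.m*n≢0 (ℓ ^ n) L {{ℕ.m^n≢0 ℓ n}})
      -- 2 * suc j reduces to suc (j + suc (j + 0)).
      ℓ^[2j+1] : ∀ j → ℓ ^ (j + suc (j + 0)) ≡ ℓ ^ j * (ℓ * ℓ ^ j)
      ℓ^[2j+1] j = trans (ℕ.^-distribˡ-+-* ℓ j (suc (j + 0))) (cong (λ e → ℓ ^ j * (ℓ * ℓ ^ e)) (ℕ.+-identityʳ j))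

    φ-ratio≡∇ : ∀ {j a} → j < a → fracℚ (φ (ℓ ^ (2 * j)) * φ (ℓ ^ (a ∸ j))) (φ (ℓ ^ a)) ≡ ∇ (λ i → ℕ→ℚ (ℓ ^ i)) j
    φ-ratio≡∇ {zero}  {suc a} _ = fracℚ-exact 1 (φ (ℓ ^ suc a)) {{φ-nonZero a}} refl
    φ-ratio≡∇ {suc j} {a} j<a with ℕ.m≤n⇒∃[o]m+o≡n j<a
    ... | r , refl = trans (fracℚ-exact (ℓ ^ j * L) (φ (ℓ ^ suc (suc (j + r)))) {{φ-nonZero (suc (j + r))}} numerator)
                           (sym (∇-pow L j))
      where
      open ≡-Reasoning
      numerator : φ (ℓ ^ (2 * suc j)) * φ (ℓ ^ (suc (suc (j + r)) ∸ suc j)) ≡ ℓ ^ j * L * φ (ℓ ^ suc (suc (j + r)))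
      numerator = begin
        φ (ℓ ^ (2 * suc j)) * φ (ℓ ^ (suc (j + r) ∸ j))
          ≡⟨ cong (λ e → φ (ℓ ^ (2 * suc j)) * φ (ℓ ^ e)) (trans (cong (_∸ j) (sym (ℕ.+-suc j r))) (ℕ.m+n∸m≡n j (suc r))) ⟩
        φ (ℓ ^ (2 * suc j)) * φ (ℓ ^ suc r)
          ≡⟨ cong₂ _*_ (φ-prime-power ℓ-prime (j + suc (j + 0))) (φ-prime-power ℓ-prime r) ⟩
        ℓ ^ (j + suc (j + 0)) * L * (ℓ ^ r * L)
          ≡⟨ cong (λ x → x * L * (ℓ ^ r * L)) (ℓ^[2j+1] j) ⟩
        ℓ ^ j * (ℓ * ℓ ^ j) * L * (ℓ ^ r * L)
          ≡⟨ NS.solve 4 (λ l x y L → x NS.:* (l NS.:* x) NS.:* L NS.:* (y NS.:* L) NS.:= x NS.:* L NS.:* (l NS.:* (x NS.:* y) NS.:* L))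
                      refl ℓ (ℓ ^ j) (ℓ ^ r) L ⟩
        ℓ ^ j * L * (ℓ * (ℓ ^ j * ℓ ^ r) * L)
          ≡⟨ cong (λ x → ℓ ^ j * L * (ℓ * x * L)) (ℕ.^-distribˡ-+-* ℓ j r) ⟨
        ℓ ^ j * L * (ℓ ^ suc (j + r) * L)
          ≡⟨ cong (ℓ ^ j * L *_) (φ-prime-power ℓ-prime (suc (j + r))) ⟨
        ℓ ^ j * L * φ (ℓ ^ suc (suc (j + r)))
          ∎

    φ-ratio-top : ∀ {a} → 0 < a → fracℚ (φ (ℓ ^ (2 * a)) * φ (ℓ ^ (a ∸ a))) (φ (ℓ ^ a)) ≡ ℕ→ℚ (ℓ ^ a)
    φ-ratio-top {suc a} _ = fracℚ-exact (ℓ ^ suc a) (φ (ℓ ^ suc a)) {{φ-nonZero a}} numerator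
      where
      open ≡-Reasoning
      numerator : φ (ℓ ^ (2 * suc a)) * φ (ℓ ^ (a ∸ a)) ≡ ℓ ^ suc a * φ (ℓ ^ suc a)
      numerator = begin
        φ (ℓ ^ (2 * suc a)) * φ (ℓ ^ (a ∸ a))  ≡⟨ cong₂ (λ x e → x * φ (ℓ ^ e)) (φ-prime-power ℓ-prime (a + suc (a + 0))) (ℕ.n∸n≡0 a) ⟩
        ℓ ^ (a + suc (a + 0)) * L * 1           ≡⟨ cong (λ x → x * L * 1) (ℓ^[2j+1] a) ⟩
        ℓ ^ a * (ℓ * ℓ ^ a) * L * 1             ≡⟨ NS.solve 3 (λ l x L → x NS.:* (l NS.:* x) NS.:* L NS.:* NS.con 1 NS.:= l NS.:* x NS.:* (x NS.:* L)) refl ℓ (ℓ ^ a) L ⟩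
        ℓ ^ suc a * (ℓ ^ a * L)                 ≡⟨ cong (ℓ ^ suc a *_) (φ-prime-power ℓ-prime a) ⟨
        ℓ ^ suc a * φ (ℓ ^ suc a)               ∎

module NatArithmetic where

  open import Data.Nat as ℕ using (zero; suc; _+_; _∸_; _≤_; _<_; s≤s)
  import Data.Nat.Properties as ℕ
  open import Relation.Binary.PropositionalEquality

  k<m∸n⇒n+suc[k]≤m : ∀ {k m} n → k < m ∸ n → n + suc k ≤ m
  k<m∸n⇒n+suc[k]≤m zero                k<m   = k<m
  k<m∸n⇒n+suc[k]≤m {m = suc m} (suc n) k<m∸n = s≤s (k<m∸n⇒n+suc[k]≤m n k<m∸n)

  m∸n≤k⇒m<n+suc[k] : ∀ {m k} n → m ∸ n ≤ k → m < n + suc k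
  m∸n≤k⇒m<n+suc[k] {m} n m∸n≤k = ℕ.≤-<-trans (ℕ.m≤n+m∸n m n) (ℕ.+-monoʳ-< n (s≤s m∸n≤k))

  ∸-comm : ∀ m n o → m ∸ n ∸ o ≡ m ∸ o ∸ n
  ∸-comm m n o = trans (ℕ.∸-+-assoc m n o) (trans (cong (m ∸_) (ℕ.+-comm n o)) (sym (ℕ.∸-+-assoc m o n)))

  suc[n∸1]≡n : ∀ {n} → 0 < n → suc (n ∸ 1) ≡ n
  suc[n∸1]≡n {suc n} _ = refl

module PowerDivisors where

  open import Data.Integer as ℤ using (∣_∣)
  open import Data.Nat as ℕ using (ℕ; _*_; _^_; _∸_; _≤_; _<_)
  import Data.Nat.Properties as ℕ
  open import Data.Nat.Divisibility using (_∣_; _∣?_; divides; ∣-trans; ∣⇒≤)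
  open import Data.Nat.GCD using (gcd; gcd[m,n]∣m; gcd-greatest)
  open import Data.Rational using (0ℚ; 1ℚ)
  open import Relation.Binary.PropositionalEquality
  open import Relation.Nullary using (¬_)
  open import Relation.Nullary.Decidable using (dec-true; dec-false)

  δ-yes : ∀ c x y → c ∣ ∣ x ℤ.- y ∣ → δ c x y ≡ 1ℚ
  δ-yes c x y c∣x-y rewrite dec-true (c ∣? ∣ x ℤ.- y ∣) c∣x-y = refl

  δ-no : ∀ c x y → ¬ c ∣ ∣ x ℤ.- y ∣ → δ c x y ≡ 0ℚ
  δ-no c x y c∤x-y rewrite dec-false (c ∣? ∣ x ℤ.- y ∣) c∤x-y = refl

  ^-monoʳ-∣ : ∀ ℓ {m n} → m ≤ n → ℓ ^ m ∣ ℓ ^ n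
  ^-monoʳ-∣ ℓ {m} {n} m≤n = divides (ℓ ^ (n ∸ m)) (begin
    ℓ ^ n                ≡⟨ cong (ℓ ^_) (ℕ.m∸n+n≡m m≤n) ⟨
    ℓ ^ (n ∸ m ℕ.+ m)    ≡⟨ ℕ.^-distribˡ-+-* ℓ (n ∸ m) m ⟩
    ℓ ^ (n ∸ m) * ℓ ^ m  ∎)
    where open ≡-Reasoning

  module _ {ℓ x β γ : ℕ} (gcd≡ℓ^β : gcd x (ℓ ^ γ) ≡ ℓ ^ β) where

    ^-∣-gcd : ∀ {n} → n ≤ β → ℓ ^ n ∣ x
    ^-∣-gcd n≤β = ∣-trans (^-monoʳ-∣ ℓ n≤β) (subst (_∣ x) gcd≡ℓ^β (gcd[m,n]∣m x (ℓ ^ γ)))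

    ^-∤-gcd : 1 < ℓ → ∀ {n} → β < n → n ≤ γ → ¬ ℓ ^ n ∣ x
    ^-∤-gcd 1<ℓ {n} β<n n≤γ ℓⁿ∣x = ℕ.<⇒≱ (ℕ.^-monoʳ-< ℓ 1<ℓ β<n)
      (∣⇒≤ {{ℕ.m^n≢0 ℓ β {{ℕ.>-nonZero (ℕ.<-trans ℕ.z<s 1<ℓ)}}}}
           (subst (ℓ ^ n ∣_) gcd≡ℓ^β (gcd-greatest ℓⁿ∣x (^-monoʳ-∣ ℓ n≤γ))))

-- Opened only from here on: the modules above open the operators of ℚ, which would
-- clash with ℤ's +_ and ℕ's _+_ and _*_.
open import Data.Integer as ℤ using (ℤ; +_; ∣_∣)
open import Data.Nat as ℕ using (ℕ; zero; suc; _^_; _∸_; _≤_; _<_)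
open import Data.Nat.GCD using (gcd)
open import Data.Nat.Primality using (Prime)
open import Relation.Binary.PropositionalEquality using (_≡_)

module Setting {L : ℕ} (ℓ-prime : Prime (suc L)) (q : ℕ) (d dinv t : ℤ) (α β γ : ℕ) (α≤β : α ≤ β)
               (gcd≡ℓ^β : gcd ∣ d ℤ.* d ℤ.* + q ℤ.- + 1 ∣ (suc L ^ γ) ≡ suc L ^ β) where

  open import Data.Nat using (_⊓_; s≤s)
  import Data.Nat.Properties as ℕ
  open import Data.Nat.Primality using (prime⇒nonTrivial)
  open import Data.Nat.Solver using () renaming (module +-*-Solver to NS)
  open import Data.Rational as ℚ using (ℚ; 0ℚ; 1ℚ; _+_; _*_; _-_)
  import Data.Rational.Properties as ℚ
  open import Data.Rational.Solver using (module +-*-Solver)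
  open import Relation.Binary.PropositionalEquality
  open +-*-Solver
  open FiniteSums
  open TotientRatios using (φ-ratio≡∇; φ-ratio-top)
  open NatArithmetic
  open PowerDivisors using (δ-yes; δ-no; ^-∣-gcd; ^-∤-gcd)

  ℓ : ℕ
  ℓ = suc L

  Δ : ℤ
  Δ = Disc t q

  D : ℕ → ℚ
  D = Dfun q d dinv t

  χ : ℕ → ℚ
  χ n = δ (ℓ ^ n) (d ℤ.* d ℤ.* + q) (+ 1)

  χ-below : ∀ {n} → n ≤ β → χ n ≡ 1ℚ
  χ-below {n} n≤β = δ-yes (ℓ ^ n) (d ℤ.* d ℤ.* + q) (+ 1) (^-∣-gcd {ℓ = ℓ} {γ = γ} gcd≡ℓ^β n≤β)

  χ-above : ∀ {n} → β < n → n ≤ γ → χ n ≡ 0ℚ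
  χ-above {n} β<n n≤γ = δ-no (ℓ ^ n) (d ℤ.* d ℤ.* + q) (+ 1)
    (^-∤-gcd {ℓ = ℓ} {γ = γ} gcd≡ℓ^β (ℕ.nonTrivial⇒n>1 ℓ {{prime⇒nonTrivial ℓ-prime}}) β<n n≤γ)

  halfH : ℕ → ℚ
  halfH n = fracℚ 1 2 * Hfrac Δ (ℓ ^ (2 ℕ.* n))

  Hsub-unfold : ∀ e n → Hsub ℓ q d dinv t e n ≡
    halfH n * χ n * D (ℓ ^ (e ℕ.+ n))
      - (∑[ k < e ∸ n ∸ 1 ] halfH (n ℕ.+ suc k) * χ (n ℕ.+ suc k) * (D (ℓ ^ (e ℕ.+ n ℕ.+ k)) - D (ℓ ^ (e ℕ.+ n ℕ.+ suc k))))
  Hsub-unfold e n = cong (halfH n * χ n * D (ℓ ^ (e ℕ.+ n)) -_) (begin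
    sumℚ 1 (e ∸ n ∸ 1) summand         ≡⟨ sumℚ≡∑< 1 (e ∸ n ∸ 1) summand ⟩
    ∑[ k < e ∸ n ∸ 1 ] summand (suc k) ≡⟨ ∑<-cong (e ∸ n ∸ 1) (λ {k} _ →
                                            cong (λ i → halfH (n ℕ.+ suc k) * χ (n ℕ.+ suc k) * (D (ℓ ^ (i ∸ 1)) - D (ℓ ^ (e ℕ.+ n ℕ.+ suc k))))
                                                 (ℕ.+-suc (e ℕ.+ n) k)) ⟩
    ∑[ k < e ∸ n ∸ 1 ] halfH (n ℕ.+ suc k) * χ (n ℕ.+ suc k) * (D (ℓ ^ (e ℕ.+ n ℕ.+ k)) - D (ℓ ^ (e ℕ.+ n ℕ.+ suc k))) ∎)
    where
    open ≡-Reasoning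
    summand : ℕ → ℚ
    summand k = halfH (n ℕ.+ k) * χ (n ℕ.+ k) * (D (ℓ ^ (e ℕ.+ n ℕ.+ k ∸ 1)) - D (ℓ ^ (e ℕ.+ n ℕ.+ k)))

  h : ℕ → ℚ
  h j = halfH (α ℕ.+ j)

  E : ℕ → ℚ
  E j = D (ℓ ^ (α ℕ.+ γ ℕ.+ j))

  -- Only the summands with α + j + k ≤ β survive, as χ vanishes strictly between β and γ.
  Hsub-reduced : ∀ {j} → α ℕ.+ j ≤ β →
    Hsub ℓ q d dinv t γ (α ℕ.+ j) ≡ h j * E j - tailSum h E ((γ ∸ (α ℕ.+ j) ∸ 1) ⊓ (β ∸ (α ℕ.+ j))) j
  Hsub-reduced {j} n≤β = begin
    Hsub ℓ q d dinv t γ n                       ≡⟨ Hsub-unfold γ n ⟩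
    halfH n * χ n * D (ℓ ^ (γ ℕ.+ n)) - ∑< N w  ≡⟨ cong₂ _-_ head (trans (∑<-truncate (ℕ.m⊓n≤m N B) dead) (∑<-cong M alive)) ⟩
    h j * E j - tailSum h E M j                 ∎
    where
    open ≡-Reasoning
    n = α ℕ.+ j
    N = γ ∸ n ∸ 1
    B = β ∸ n
    M = N ⊓ B
    ΔD : ℕ → ℚ
    ΔD k = D (ℓ ^ (γ ℕ.+ n ℕ.+ k)) - D (ℓ ^ (γ ℕ.+ n ℕ.+ suc k))
    w : ℕ → ℚ
    w k = halfH (n ℕ.+ suc k) * χ (n ℕ.+ suc k) * ΔD k
    head : halfH n * χ n * D (ℓ ^ (γ ℕ.+ n)) ≡ h j * E j
    head = begin
      halfH n * χ n * D (ℓ ^ (γ ℕ.+ n))  ≡⟨ cong₂ (λ c i → halfH n * c * D (ℓ ^ i)) (χ-below n≤β)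
                                                  (NS.solve 3 (λ a g j → g NS.:+ (a NS.:+ j) NS.:= a NS.:+ g NS.:+ j) refl α γ j) ⟩
      halfH n * 1ℚ * E j                 ≡⟨ cong (_* E j) (ℚ.*-identityʳ (halfH n)) ⟩
      h j * E j                          ∎
    dead : ∀ {k} → M ≤ k → k < N → w k ≡ 0ℚ
    dead {k} M≤k k<N = begin
      halfH (n ℕ.+ suc k) * χ (n ℕ.+ suc k) * ΔD k  ≡⟨ cong (λ c → halfH (n ℕ.+ suc k) * c * ΔD k) (χ-above β<n+1+k n+1+k≤γ) ⟩
      halfH (n ℕ.+ suc k) * 0ℚ * ΔD k               ≡⟨ cong (_* ΔD k) (ℚ.*-zeroʳ (halfH (n ℕ.+ suc k))) ⟩
      0ℚ * ΔD k                                     ≡⟨ ℚ.*-zeroˡ (ΔD k) ⟩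
      0ℚ                                            ∎
      where
      β<n+1+k : β < n ℕ.+ suc k
      β<n+1+k = m∸n≤k⇒m<n+suc[k] n (ℕ.≮⇒≥ λ k<B → ℕ.<⇒≱ (ℕ.⊓-glb k<N k<B) M≤k)
      n+1+k≤γ : n ℕ.+ suc k ≤ γ
      n+1+k≤γ = k<m∸n⇒n+suc[k]≤m n (ℕ.<-≤-trans k<N (ℕ.m∸n≤m (γ ∸ n) 1))
    alive : ∀ {k} → k < M → w k ≡ h (suc (j ℕ.+ k)) * (E (j ℕ.+ k) - E (suc (j ℕ.+ k)))
    alive {k} k<M = begin
      halfH (n ℕ.+ suc k) * χ (n ℕ.+ suc k) * ΔD k
        ≡⟨ cong (λ c → halfH (n ℕ.+ suc k) * c * ΔD k) (χ-below (k<m∸n⇒n+suc[k]≤m n (ℕ.<-≤-trans k<M (ℕ.m⊓n≤n N B)))) ⟩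
      halfH (n ℕ.+ suc k) * 1ℚ * ΔD k
        ≡⟨ cong (_* ΔD k) (ℚ.*-identityʳ (halfH (n ℕ.+ suc k))) ⟩
      halfH (n ℕ.+ suc k) * ΔD k
        ≡⟨ cong₂ (λ i x → halfH i * x)
             (NS.solve 3 (λ a j k → a NS.:+ j NS.:+ (NS.con 1 NS.:+ k) NS.:= a NS.:+ (NS.con 1 NS.:+ (j NS.:+ k))) refl α j k)
             (cong₂ (λ x y → D (ℓ ^ x) - D (ℓ ^ y))
               (NS.solve 4 (λ a g j k → g NS.:+ (a NS.:+ j) NS.:+ k NS.:= a NS.:+ g NS.:+ (j NS.:+ k)) refl α γ j k)
               (NS.solve 4 (λ a g j k → g NS.:+ (a NS.:+ j) NS.:+ (NS.con 1 NS.:+ k) NS.:= a NS.:+ g NS.:+ (NS.con 1 NS.:+ (j NS.:+ k))) refl α γ j k)) ⟩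
      h (suc (j ℕ.+ k)) * (E (j ℕ.+ k) - E (suc (j ℕ.+ k)))
        ∎

  P : ℕ → ℚ
  P j = ℕ→ℚ (ℓ ^ j)

  PE : ℕ → ℚ
  PE i = P i * E i

  H : ℕ → ℚ
  H j = Hfrac Δ (ℓ ^ (2 ℕ.* (α ℕ.+ j)))

  term : ℕ → ℚ
  term j = Hfrac Δ (ℓ ^ (2 ℕ.* (α ℕ.+ j)))
           * (ℕ→ℚ (ℓ ^ j) * D (ℓ ^ (α ℕ.+ γ ℕ.+ j)) - ℕ→ℚ (ℓ ^ (j ∸ 1)) * D (ℓ ^ (α ℕ.+ γ ℕ.+ j ∸ 1)))

  leading : ℚ
  leading = Hfrac Δ (ℓ ^ (2 ℕ.* α)) * D (ℓ ^ (α ℕ.+ γ))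

  twice-half : ∀ x y → ℕ→ℚ 2 * (fracℚ 1 2 * x * y) ≡ x * y
  twice-half x y = begin
    ℕ→ℚ 2 * (fracℚ 1 2 * x * y)    ≡⟨ cong (ℕ→ℚ 2 *_) (ℚ.*-assoc (fracℚ 1 2) x y) ⟩
    ℕ→ℚ 2 * (fracℚ 1 2 * (x * y))  ≡⟨ ℚ.*-assoc (ℕ→ℚ 2) (fracℚ 1 2) (x * y) ⟨
    1ℚ * (x * y)                    ≡⟨ ℚ.*-identityˡ (x * y) ⟩
    x * y                           ∎
    where open ≡-Reasoning

  twice-∑-by-parts : ∀ n → ℕ→ℚ 2 * (∑[ k < suc n ] h k * ∇ PE k) ≡ leading + sumℚ 1 n term
  twice-∑-by-parts n = begin
    ℕ→ℚ 2 * (∑[ k < suc n ] h k * ∇ PE k)                                     ≡⟨ ∑<-distribˡ (suc n) (ℕ→ℚ 2) (λ k → h k * ∇ PE k) ⟩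
    ℕ→ℚ 2 * (h 0 * (1ℚ * E 0)) + (∑[ k < n ] ℕ→ℚ 2 * (h (suc k) * ∇ PE (suc k)))
      ≡⟨ cong₂ _+_ head (∑<-cong n λ {k} _ → trans (twice-half (H (suc k)) (∇ PE (suc k)))
           (cong (λ i → H (suc k) * (P (suc k) * E (suc k) - P k * D (ℓ ^ (i ∸ 1)))) (sym (ℕ.+-suc (α ℕ.+ γ) k)))) ⟩
    leading + (∑[ k < n ] term (suc k))                                        ≡⟨ cong (_+_ leading) (sumℚ≡∑< 1 n term) ⟨
    leading + sumℚ 1 n term                                                    ∎
    where
    open ≡-Reasoning
    head : ℕ→ℚ 2 * (h 0 * (1ℚ * E 0)) ≡ leading
    head = begin
      ℕ→ℚ 2 * (h 0 * (1ℚ * E 0))                                ≡⟨ cong (λ x → ℕ→ℚ 2 * (h 0 * x)) (ℚ.*-identityˡ (E 0)) ⟩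
      ℕ→ℚ 2 * (h 0 * E 0)                                       ≡⟨ twice-half (H 0) (E 0) ⟩
      Hfrac Δ (ℓ ^ (2 ℕ.* (α ℕ.+ 0))) * D (ℓ ^ (α ℕ.+ γ ℕ.+ 0))  ≡⟨ cong₂ (λ a b → Hfrac Δ (ℓ ^ (2 ℕ.* a)) * D (ℓ ^ b))
                                                                          (ℕ.+-identityʳ α) (ℕ.+-identityʳ (α ℕ.+ γ)) ⟩
      leading                                                   ∎

  coef : ℕ → ℚ
  coef j = fracℚ (φ (ℓ ^ (2 ℕ.* j)) ℕ.* φ (ℓ ^ (γ ∸ α ∸ j))) (φ (ℓ ^ (γ ∸ α)))

  Hs : ℕ → ℚ
  Hs j = Hsub ℓ q d dinv t γ (α ℕ.+ j)

  LHS : ℚ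
  LHS = ℕ→ℚ 2 * sumℚ 0 (β ∸ α) (λ j → coef j * Hs j)

  by-parts-form : ∀ {b} → (∀ {j} → j ≤ b → coef j * Hs j ≡ ∇ P j * (h j * E j - tailSum h E (b ∸ j) j)) →
                  ℕ→ℚ 2 * (∑[ j < suc b ] coef j * Hs j) ≡ leading + sumℚ 1 b term
  by-parts-form {b} summand = begin
    ℕ→ℚ 2 * (∑[ j < suc b ] coef j * Hs j)                                ≡⟨ cong (ℕ→ℚ 2 *_) (∑<-cong (suc b) λ { (s≤s j≤b) → summand j≤b }) ⟩
    ℕ→ℚ 2 * (∑[ j < suc b ] ∇ P j * (h j * E j - tailSum h E (b ∸ j) j))  ≡⟨ cong (ℕ→ℚ 2 *_) (summation-by-parts P h E b) ⟩
    ℕ→ℚ 2 * (∑[ k < suc b ] h k * ∇ PE k)                                 ≡⟨ twice-∑-by-parts b ⟩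
    leading + sumℚ 1 b term                                                ∎
    where open ≡-Reasoning

  identity-β<γ : β < γ → LHS ≡ leading + sumℚ 1 (β ∸ α) term
  identity-β<γ β<γ = trans (cong (ℕ→ℚ 2 *_) (sumℚ≡∑< 0 (β ∸ α) (λ j → coef j * Hs j))) (by-parts-form summand)
    where
    summand : ∀ {j} → j ≤ β ∸ α → coef j * Hs j ≡ ∇ P j * (h j * E j - tailSum h E (β ∸ α ∸ j) j)
    summand {j} j≤b = cong₂ _*_ (φ-ratio≡∇ ℓ-prime (ℕ.≤-<-trans j≤b (ℕ.∸-monoˡ-< β<γ α≤β)))
                                (trans (Hsub-reduced α+j≤β) (cong (λ m → h j * E j - tailSum h E m j) tail-length))
      where
      α+j≤β : α ℕ.+ j ≤ β
      α+j≤β = subst (_≤ β) (ℕ.+-comm j α) (ℕ.m≤o∸n⇒m+n≤o j α≤β j≤b)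
      tail-length : (γ ∸ (α ℕ.+ j) ∸ 1) ⊓ (β ∸ (α ℕ.+ j)) ≡ β ∸ α ∸ j
      tail-length = trans (ℕ.m≥n⇒m⊓n≡n (subst (β ∸ (α ℕ.+ j) ≤_) (∸-comm γ 1 (α ℕ.+ j)) (ℕ.∸-monoˡ-≤ (α ℕ.+ j) (ℕ.∸-monoˡ-≤ 1 β<γ))))
                          (sym (ℕ.∸-+-assoc β α j))

  identity-β≡γ : β ≡ γ → α < γ →
    LHS ≡ leading + sumℚ 1 (γ ∸ α ∸ 1) term + ℕ→ℚ (ℓ ^ (γ ∸ α)) * D (ℓ ^ (2 ℕ.* γ)) * Hfrac Δ (ℓ ^ (2 ℕ.* γ))
  identity-β≡γ β≡γ α<γ = begin
    ℕ→ℚ 2 * sumℚ 0 (β ∸ α) f                    ≡⟨ cong (ℕ→ℚ 2 *_) (trans (sumℚ≡∑< 0 (β ∸ α) f) (cong (λ n → ∑< (suc n) f) β∸α≡1+a′)) ⟩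
    ℕ→ℚ 2 * ∑< (suc (suc a′)) f                 ≡⟨ cong (ℕ→ℚ 2 *_) (∑<-suc (suc a′) f) ⟩
    ℕ→ℚ 2 * (∑< (suc a′) f + f (suc a′))        ≡⟨ ℚ.*-distribˡ-+ (ℕ→ℚ 2) (∑< (suc a′) f) (f (suc a′)) ⟩
    ℕ→ℚ 2 * ∑< (suc a′) f + ℕ→ℚ 2 * f (suc a′)  ≡⟨ cong₂ _+_ (by-parts-form summand) top ⟩
    leading + sumℚ 1 a′ term + P a * D (ℓ ^ (2 ℕ.* γ)) * Hfrac Δ (ℓ ^ (2 ℕ.* γ)) ∎
    where
    open ≡-Reasoning
    f : ℕ → ℚ
    f j = coef j * Hs j
    a = γ ∸ α
    a′ = a ∸ 1
    0<a : 0 < a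
    0<a = ℕ.m<n⇒0<n∸m α<γ
    1+a′≡a : suc a′ ≡ a
    1+a′≡a = suc[n∸1]≡n 0<a
    β∸α≡1+a′ : β ∸ α ≡ suc a′
    β∸α≡1+a′ = trans (cong (_∸ α) β≡γ) (sym 1+a′≡a)
    α+a≡γ : α ℕ.+ a ≡ γ
    α+a≡γ = ℕ.m+[n∸m]≡n (ℕ.<⇒≤ α<γ)

    summand : ∀ {j} → j ≤ a′ → coef j * Hs j ≡ ∇ P j * (h j * E j - tailSum h E (a′ ∸ j) j)
    summand {j} j≤a′ = cong₂ _*_ (φ-ratio≡∇ ℓ-prime j<a)
                                 (trans (Hsub-reduced α+j≤β) (cong (λ m → h j * E j - tailSum h E m j) tail-length))
      where
      j<a : j < a
      j<a = subst (j <_) 1+a′≡a (s≤s j≤a′)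
      α+j≤β : α ℕ.+ j ≤ β
      α+j≤β = subst (α ℕ.+ j ≤_) (sym β≡γ) (ℕ.<⇒≤ (subst (_≤ γ) (ℕ.+-suc α j) (k<m∸n⇒n+suc[k]≤m α j<a)))
      tail-length : (γ ∸ (α ℕ.+ j) ∸ 1) ⊓ (β ∸ (α ℕ.+ j)) ≡ a′ ∸ j
      tail-length = begin
        (γ ∸ (α ℕ.+ j) ∸ 1) ⊓ (β ∸ (α ℕ.+ j))  ≡⟨ cong (λ x → (γ ∸ (α ℕ.+ j) ∸ 1) ⊓ (x ∸ (α ℕ.+ j))) β≡γ ⟩
        (γ ∸ (α ℕ.+ j) ∸ 1) ⊓ (γ ∸ (α ℕ.+ j))  ≡⟨ ℕ.m≤n⇒m⊓n≡m (ℕ.m∸n≤m (γ ∸ (α ℕ.+ j)) 1) ⟩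
        γ ∸ (α ℕ.+ j) ∸ 1                      ≡⟨ cong (_∸ 1) (ℕ.∸-+-assoc γ α j) ⟨
        a ∸ j ∸ 1                              ≡⟨ ∸-comm a j 1 ⟩
        a′ ∸ j                                 ∎

    Hs-top : Hs a ≡ h a * E a
    Hs-top = begin
      Hs a                                                             ≡⟨ Hsub-reduced (subst (α ℕ.+ a ≤_) (sym β≡γ) (ℕ.≤-reflexive α+a≡γ)) ⟩
      h a * E a - tailSum h E ((γ ∸ (α ℕ.+ a) ∸ 1) ⊓ (β ∸ (α ℕ.+ a))) a
        ≡⟨ cong (λ m → h a * E a - tailSum h E ((m ∸ 1) ⊓ (β ∸ (α ℕ.+ a))) a) (trans (cong (γ ∸_) α+a≡γ) (ℕ.n∸n≡0 γ)) ⟩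
      h a * E a - 0ℚ                                                   ≡⟨ ℚ.+-identityʳ (h a * E a) ⟩
      h a * E a                                                        ∎

    top : ℕ→ℚ 2 * f (suc a′) ≡ P a * D (ℓ ^ (2 ℕ.* γ)) * Hfrac Δ (ℓ ^ (2 ℕ.* γ))
    top = begin
      ℕ→ℚ 2 * (coef (suc a′) * Hs (suc a′))  ≡⟨ cong (λ j → ℕ→ℚ 2 * (coef j * Hs j)) 1+a′≡a ⟩
      ℕ→ℚ 2 * (coef a * Hs a)                ≡⟨ cong₂ (λ c x → ℕ→ℚ 2 * (c * x)) (φ-ratio-top ℓ-prime 0<a) Hs-top ⟩
      ℕ→ℚ 2 * (P a * (h a * E a))            ≡⟨ solve 3 (λ t p x → t :* (p :* x) := p :* (t :* x)) refl (ℕ→ℚ 2) (P a) (h a * E a) ⟩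
      P a * (ℕ→ℚ 2 * (h a * E a))            ≡⟨ cong (P a *_) (twice-half (H a) (E a)) ⟩
      P a * (H a * E a)                      ≡⟨ cong₂ (λ i k → P a * (Hfrac Δ (ℓ ^ (2 ℕ.* i)) * D (ℓ ^ k))) α+a≡γ α+γ+a≡2γ ⟩
      P a * (Hfrac Δ (ℓ ^ (2 ℕ.* γ)) * D (ℓ ^ (2 ℕ.* γ)))
        ≡⟨ solve 3 (λ p x y → p :* (x :* y) := p :* y :* x) refl (P a) (Hfrac Δ (ℓ ^ (2 ℕ.* γ))) (D (ℓ ^ (2 ℕ.* γ))) ⟩
      P a * D (ℓ ^ (2 ℕ.* γ)) * Hfrac Δ (ℓ ^ (2 ℕ.* γ)) ∎
      where
      α+γ+a≡2γ : α ℕ.+ γ ℕ.+ a ≡ 2 ℕ.* γ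
      α+γ+a≡2γ = begin
        α ℕ.+ γ ℕ.+ a    ≡⟨ NS.solve 3 (λ x y z → x NS.:+ y NS.:+ z NS.:= y NS.:+ (x NS.:+ z)) refl α γ a ⟩
        γ ℕ.+ (α ℕ.+ a)  ≡⟨ cong (γ ℕ.+_) (trans α+a≡γ (sym (ℕ.+-identityʳ γ))) ⟩
        2 ℕ.* γ          ∎

open import Data.Empty using (⊥-elim)
open import Data.Nat using (_+_; _*_)
open import Data.Nat.Divisibility using (_∣_)
open import Data.Nat.Primality using (prime⇒nonZero)
import Data.Rational as ℚ
open import Data.Product using (_×_; _,_)
open import Relation.Nullary using (¬_)
open import Relation.Binary.PropositionalEquality using (refl)

-- Only α ≤ β and the gcd condition are used: the hypotheses on q and on d·d⁻¹ serve
-- in the paper to make D(t; n) well defined, and β ≤ γ follows from the gcd condition.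
lemma12 : (q p k : ℕ) → Prime p → 1 ≤ k → q ≡ p ^ k →
          (ℓ : ℕ) → Prime ℓ → ¬ (ℓ ∣ q) →
          (α β γ : ℕ) → α ≤ β → β ≤ γ →
          (d dinv : ℤ) → ℓ ^ (γ + β) ∣ ∣ d ℤ.* dinv ℤ.- + 1 ∣ →
          gcd ∣ d ℤ.* d ℤ.* + q ℤ.- + 1 ∣ (ℓ ^ γ) ≡ ℓ ^ β →
          (t : ℤ) →
          let Δ = Disc t q
              D = Dfun q d dinv t
              LHS = ℕ→ℚ 2 ℚ.* sumℚ 0 (β ∸ α) (λ j →
                      fracℚ (φ (ℓ ^ (2 * j)) * φ (ℓ ^ (γ ∸ α ∸ j))) (φ (ℓ ^ (γ ∸ α)))
                      ℚ.* Hsub ℓ q d dinv t γ (α + j))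
              term = λ j → Hfrac Δ (ℓ ^ (2 * (α + j)))
                      ℚ.* (ℕ→ℚ (ℓ ^ j) ℚ.* D (ℓ ^ (α + γ + j))
                           ℚ.- ℕ→ℚ (ℓ ^ (j ∸ 1)) ℚ.* D (ℓ ^ (α + γ + j ∸ 1)))
          in (β < γ →
                LHS ≡ Hfrac Δ (ℓ ^ (2 * α)) ℚ.* D (ℓ ^ (α + γ))
                      ℚ.+ sumℚ 1 (β ∸ α) term)
             × (β ≡ γ → α < γ →
                LHS ≡ Hfrac Δ (ℓ ^ (2 * α)) ℚ.* D (ℓ ^ (α + γ))
                      ℚ.+ sumℚ 1 (γ ∸ α ∸ 1) term
                      ℚ.+ ℕ→ℚ (ℓ ^ (γ ∸ α)) ℚ.* D (ℓ ^ (2 * γ)) ℚ.* Hfrac Δ (ℓ ^ (2 * γ)))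
lemma12 _ _ _ _ _ _ zero ℓ-prime _ = ⊥-elim (ℕ.≢-nonZero⁻¹ 0 {{prime⇒nonZero ℓ-prime}} refl)
lemma12 q _ _ _ _ _ (suc L) ℓ-prime _ α β γ α≤β _ d dinv _ gcd≡ℓ^β t = identity-β<γ , identity-β≡γ
  where open Setting ℓ-prime q d dinv t α β γ α≤β gcd≡ℓ^β
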